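{- Let $m \geq 2$. Then $w_{4,2^{m}}^{+}=(m+2)2^{m-1}$ and $w_{4,2^{m}}^{ - }=2^{m}$.
   Context: For $a_1,\ldots,a_n\in\mathbb{Z}/2^m\mathbb{Z}$, $M_{n}(a_1,\ldots,a_n):=\begin{pmatrix} a_{n} & -1 \\ 1 & 0\end{pmatrix}\cdots\begin{pmatrix} a_{1} & -1 \\ 1 & 0\end{pmatrix}$. $w_{n,2^{m}}^{+}$ (resp. $w_{n,2^{m}}^{ - }$) denotes the number of $(a_1,\ldots,a_n)\in(\mathbb{Z}/2^m\mathbb{Z})^n$ with $M_n(a_1,\ldots,a_n)=Id$ (resp. $=-Id$). -}

module Defs where

open import Data.Nat using (ℕ; zero; suc; _+_; _*_; _∸_; _^_; NonZero)
open import Data.Nat.DivMod using (_%_)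
open import Data.Nat.Properties using (_≟_; m^n≢0)
open import Data.Fin using (Fin; toℕ; fromℕ<)
open import Data.Fin.Properties using (all?) renaming (_≟_ to _≟ᶠ_)
open import Data.Nat.DivMod using (m%n<n)
open import Data.List using (List; length; filter; allFin; concatMap; map)
open import Data.Product using (_×_; _,_)
open import Relation.Nullary using (Dec; yes; no)
open import Relation.Nullary.Decidable using (_×-dec_)
open import Relation.Binary.PropositionalEquality using (_≡_)

module ZMod (N : ℕ) .{{_ : NonZero N}} where

  Zn : Set
  Zn = Fin N

  [_] : ℕ → Zn
  [ k ] = fromℕ< (m%n<n k N)

  _+ₙ_ : Zn → Zn → Zn
  a +ₙ b = [ toℕ a + toℕ b ]

  _*ₙ_ : Zn → Zn → Zn
  a *ₙ b = [ toℕ a * toℕ b ]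

  -ₙ_ : Zn → Zn
  -ₙ a = [ N ∸ toℕ a ]

  0ₙ 1ₙ : Zn
  0ₙ = [ 0 ]
  1ₙ = [ 1 ]

  record Mat : Set where
    constructor mat
    field
      e₁₁ e₁₂ e₂₁ e₂₂ : Zn

  _·_ : Mat → Mat → Mat
  mat a b c d · mat a' b' c' d' =
    mat ((a *ₙ a') +ₙ (b *ₙ c')) ((a *ₙ b') +ₙ (b *ₙ d'))
        ((c *ₙ a') +ₙ (d *ₙ c')) ((c *ₙ b') +ₙ (d *ₙ d'))

  Id : Mat
  Id = mat 1ₙ 0ₙ 0ₙ 1ₙ

  -Id : Mat
  -Id = mat (-ₙ 1ₙ) 0ₙ 0ₙ (-ₙ 1ₙ)

  S : Zn → Mat
  S a = mat a (-ₙ 1ₙ) 1ₙ 0ₙ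

  M₄ : Zn → Zn → Zn → Zn → Mat
  M₄ a₁ a₂ a₃ a₄ = S a₄ · (S a₃ · (S a₂ · S a₁))

  _≟ₘ_ : (x y : Mat) → Dec (x ≡ y)
  mat a b c d ≟ₘ mat a' b' c' d' with a ≟ᶠ a' | b ≟ᶠ b' | c ≟ᶠ c' | d ≟ᶠ d'
  ... | yes _≡_.refl | yes _≡_.refl | yes _≡_.refl | yes _≡_.refl = yes _≡_.refl
  ... | no p | _ | _ | _ = no λ { _≡_.refl → p _≡_.refl }
  ... | yes _ | no p | _ | _ = no λ { _≡_.refl → p _≡_.refl }
  ... | yes _ | yes _ | no p | _ = no λ { _≡_.refl → p _≡_.refl }
  ... | yes _ | yes _ | yes _ | no p = no λ { _≡_.refl → p _≡_.refl }

  tuples₄ : List (Zn × Zn × Zn × Zn)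
  tuples₄ = concatMap (λ a → concatMap (λ b → concatMap (λ c → map (λ d → (a , b , c , d)) (allFin N)) (allFin N)) (allFin N)) (allFin N)

  count₄ : Mat → ℕ
  count₄ T = length (filter (λ { (a , b , c , d) → M₄ a b c d ≟ₘ T }) tuples₄)

  w⁺₄ w⁻₄ : ℕ
  w⁺₄ = count₄ Id
  w⁻₄ = count₄ -Id

w⁺ : ℕ → ℕ
w⁺ m = ZMod.w⁺₄ (2 ^ m) {{m^n≢0 2 m}}

w⁻ : ℕ → ℕ
w⁻ m = ZMod.w⁻₄ (2 ^ m) {{m^n≢0 2 m}}

{-# OPTIONS --safe #-}
-- Multiplying out, S d · S c · S b · S a has the continuant entries
-- (1 − ba − da − dc + dcba, b + d − dcb ; cba − c − a, 1 − cb). Reading them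
-- modulo n, the product is Id exactly when c = −a, d = −b and ab = 0, and −Id
-- exactly when c = a, d = b and ab = 2. So w⁺ and w⁻ count the pairs (a, b) with
-- ab ≡ 0, resp. ab ≡ 2, modulo 2^m. Modulo 2^(k+1) every odd a is a unit and has
-- exactly one partner b, while a = 2i solves 2ib ≡ 2c iff ib ≡ c modulo 2^k, with
-- two b per solution, and never solves 2ib ≡ 1. Writing P(n, r) for the number of pairs,
-- P(2^(k+1), 2c) = 2 P(2^k, c) + 2^k and P(2^(k+1), 1) = 2^k, which give
-- P(2^m, 0) = (m + 2) 2^(m−1) and P(2^m, 2) = 2^m.
module Submission where

open import Level using (0ℓ)
open import Function using (_∘_; _$_; id; _⇔_; mk⇔; Equivalence)
open import Function.Properties.Equivalence using (⇔-setoid) renaming (sym to ⇔-sym)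
open import Data.Bool using (true; false; if_then_else_)
open import Data.Product using (_×_; _,_; ∃-syntax)
open import Data.Product.Function.NonDependent.Propositional using (_×-⇔_)
open import Data.Fin using (Fin; toℕ)
open import Data.Fin.Properties using (toℕ-injective; toℕ<n; toℕ-fromℕ<) renaming (_≟_ to _≟ᶠ_)
open import Data.List using (List; []; _∷_; _++_; map; filter; concatMap; tabulate; allFin; length)
open import Data.List.Properties using (map-++; map-∘; map-cong; map-tabulate)
open import Data.Nat.Base as ℕ using (ℕ; zero; suc; NonZero)
open import Data.Nat.ListAction using (sum)
open import Data.Nat.ListAction.Properties using (sum-++)
open import Data.Integer.Base using (ℤ)
open import Data.Integer.Divisibility.Signed using (_∣_; divides; ∣m∣n⇒∣m+n; ∣m⇒∣-m; ∣n⇒∣m*n; ∣m⇒∣m*n; *-monoʳ-∣; module ∣-Reasoning)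
open import Relation.Nullary using (Dec; does; ¬_; yes; no; contradiction)
open import Relation.Nullary.Decidable using (_×-dec_)
open import Relation.Unary using (Pred; Decidable)
open import Relation.Binary using (IsEquivalence; Setoid)
open import Relation.Binary.PropositionalEquality using (_≡_; _≢_; refl; sym; trans; cong; cong₂; subst; subst₂; module ≡-Reasoning)
import Relation.Binary.Reasoning.Setoid
open import Defs

module ⇔-Reasoning = Relation.Binary.Reasoning.Setoid (⇔-setoid 0ℓ)

module _ where
  open import Data.Nat
  open import Data.Nat.Properties
  open import Data.Nat.Tactic.RingSolver using (solve-∀)
  open ≡-Reasoning

  𝟙 : ∀ {p} {P : Set p} → Dec P → ℕ
  𝟙 P? = if does P? then 1 else 0

  𝟙-no : ∀ {p} {P : Set p} → ¬ P → (P? : Dec P) → 𝟙 P? ≡ 0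
  𝟙-no ¬p (yes p) = contradiction p ¬p
  𝟙-no ¬p (no _) = refl

  module _ {p q} {P : Set p} {Q : Set q} where

    𝟙-cong : P ⇔ Q → (P? : Dec P) (Q? : Dec Q) → 𝟙 P? ≡ 𝟙 Q?
    𝟙-cong _ (yes _) (yes _) = refl
    𝟙-cong P⇔Q (yes p) (no ¬q) = contradiction (Equivalence.to P⇔Q p) ¬q
    𝟙-cong P⇔Q (no ¬p) (yes q) = contradiction (Equivalence.from P⇔Q q) ¬p
    𝟙-cong _ (no _) (no _) = refl

    𝟙-× : (P? : Dec P) (Q? : Dec Q) → 𝟙 (P? ×-dec Q?) ≡ 𝟙 P? * 𝟙 Q?
    𝟙-× (yes _) (yes _) = refl
    𝟙-× (yes _) (no _) = refl
    𝟙-× (no _) _ = refl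

  ∑< : ℕ → (ℕ → ℕ) → ℕ
  ∑< zero f = 0
  ∑< (suc n) f = f 0 + ∑< n (f ∘ suc)

  syntax ∑< n (λ i → e) = ∑[ i < n ] e

  ∑-cong : ∀ n {f g : ℕ → ℕ} → (∀ {i} → i < n → f i ≡ g i) → ∑< n f ≡ ∑< n g
  ∑-cong zero _ = refl
  ∑-cong (suc n) f≗g = cong₂ _+_ (f≗g z<s) (∑-cong n (f≗g ∘ s<s))

  ∑-zero : ∀ n → ∑< n (λ _ → 0) ≡ 0
  ∑-zero zero = refl
  ∑-zero (suc n) = ∑-zero n

  ∑-const : ∀ n k → ∑< n (λ _ → k) ≡ n * k
  ∑-const zero k = refl
  ∑-const (suc n) k = cong (k +_) (∑-const n k)

  ∑-*ˡ : ∀ n k f → ∑[ i < n ] (k * f i) ≡ k * ∑< n f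
  ∑-*ˡ zero k f = sym (*-zeroʳ k)
  ∑-*ˡ (suc n) k f = trans (cong (k * f 0 +_) (∑-*ˡ n k (f ∘ suc))) (sym (*-distribˡ-+ k (f 0) _))

  ∑-+ : ∀ m n f → ∑< (m + n) f ≡ ∑< m f + ∑[ i < n ] f (m + i)
  ∑-+ zero n f = refl
  ∑-+ (suc m) n f = trans (cong (f 0 +_) (∑-+ m n (f ∘ suc))) (sym (+-assoc (f 0) _ _))

  ∑-periodic : ∀ n f → (∀ i → f (n + i) ≡ f i) → ∑< (2 * n) f ≡ 2 * ∑< n f
  ∑-periodic n f f-periodic = begin
    ∑< (n + (n + 0)) f                       ≡⟨ ∑-+ n (n + 0) f ⟩
    ∑< n f + ∑[ i < n + 0 ] f (n + i)         ≡⟨ cong (∑< n f +_) (∑-+ n 0 (λ i → f (n + i))) ⟩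
    ∑< n f + (∑[ i < n ] f (n + i) + 0)       ≡⟨ cong (λ s → ∑< n f + (s + 0)) (∑-cong n (λ {i} _ → f-periodic i)) ⟩
    ∑< n f + (∑< n f + 0)                     ∎

  ∑-even-odd : ∀ n f → ∑< (2 * n) f ≡ ∑[ i < n ] f (2 * i) + ∑[ i < n ] f (1 + 2 * i)
  ∑-even-odd zero f = refl
  ∑-even-odd (suc n) f = begin
    f 0 + ∑[ i < n + suc (n + 0) ] f (suc i)
      ≡⟨ cong (λ m → f 0 + ∑[ i < m ] f (suc i)) (+-suc n (n + 0)) ⟩
    f 0 + (f 1 + ∑[ i < 2 * n ] f (2 + i))
      ≡⟨ cong (λ s → f 0 + (f 1 + s)) (∑-even-odd n (λ i → f (2 + i))) ⟩
    f 0 + (f 1 + (∑[ i < n ] f (2 + 2 * i) + ∑[ i < n ] f (3 + 2 * i)))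
      ≡⟨ interchange (f 0) (f 1) _ _ ⟩
    (f 0 + ∑[ i < n ] f (2 + 2 * i)) + (f 1 + ∑[ i < n ] f (3 + 2 * i))
      ≡⟨ cong₂ (λ s t → (f 0 + s) + (f 1 + t))
           (∑-cong n (λ {i} _ → cong f (sym (*-suc 2 i))))
           (∑-cong n (λ {i} _ → cong (f ∘ suc) (sym (*-suc 2 i)))) ⟩
    ∑[ i < suc n ] f (2 * i) + ∑[ i < suc n ] f (1 + 2 * i)
      ∎
    where
    interchange : ∀ a b c d → a + (b + (c + d)) ≡ (a + c) + (b + d)
    interchange = solve-∀

  -- 𝟙 (suc y ≟ suc y₀) reduces to 𝟙 (y ≟ y₀), so no case analysis on y is needed.
  ∑-delta : ∀ n {y₀} → y₀ < n → ∑[ y < n ] 𝟙 (y ≟ y₀) ≡ 1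
  ∑-delta (suc n) {zero} _ = cong suc (∑-zero n)
  ∑-delta (suc n) {suc y₀} (s<s y₀<n) = ∑-delta n y₀<n

  ∑∈ : ∀ {a} {A : Set a} → List A → (A → ℕ) → ℕ
  ∑∈ xs f = sum (map f xs)

  syntax ∑∈ xs (λ x → e) = ∑[ x ∈ xs ] e

  module _ {a} {A : Set a} where

    length-filter : ∀ {p} {P : Pred A p} (P? : Decidable P) xs →
                    length (filter P? xs) ≡ ∑[ x ∈ xs ] 𝟙 (P? x)
    length-filter P? [] = refl
    length-filter P? (x ∷ xs) with does (P? x)
    ... | true = cong suc (length-filter P? xs)
    ... | false = length-filter P? xs

    ∑∈-cong : ∀ {f g : A → ℕ} xs → (∀ x → f x ≡ g x) → ∑∈ xs f ≡ ∑∈ xs g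
    ∑∈-cong xs f≗g = cong sum (map-cong f≗g xs)

    ∑∈-*ˡ : ∀ k (f : A → ℕ) xs → ∑[ x ∈ xs ] (k * f x) ≡ k * ∑∈ xs f
    ∑∈-*ˡ k f [] = sym (*-zeroʳ k)
    ∑∈-*ˡ k f (x ∷ xs) = trans (cong (k * f x +_) (∑∈-*ˡ k f xs)) (sym (*-distribˡ-+ k (f x) _))

    ∑∈-map : ∀ {b} {B : Set b} (g : A → B) (f : B → ℕ) xs → ∑∈ (map g xs) f ≡ ∑[ x ∈ xs ] f (g x)
    ∑∈-map g f xs = cong sum (sym (map-∘ xs))

    ∑∈-concatMap : ∀ {b} {B : Set b} (g : A → List B) (f : B → ℕ) xs →
                   ∑∈ (concatMap g xs) f ≡ ∑[ x ∈ xs ] ∑∈ (g x) f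
    ∑∈-concatMap g f [] = refl
    ∑∈-concatMap g f (x ∷ xs) = begin
      sum (map f (g x ++ concatMap g xs))          ≡⟨ cong sum (map-++ f (g x) _) ⟩
      sum (map f (g x) ++ map f (concatMap g xs))  ≡⟨ sum-++ (map f (g x)) _ ⟩
      ∑∈ (g x) f + ∑∈ (concatMap g xs) f           ≡⟨ cong (∑∈ (g x) f +_) (∑∈-concatMap g f xs) ⟩
      ∑∈ (g x) f + ∑[ y ∈ xs ] ∑∈ (g y) f          ∎

  ∑∈allFin : ∀ n (f : ℕ → ℕ) → ∑[ i ∈ allFin n ] f (toℕ i) ≡ ∑< n f
  ∑∈allFin n f = trans (cong sum (map-tabulate {n = n} id (f ∘ toℕ))) (sum-tabulate n f)
    where
    sum-tabulate : ∀ n (f : ℕ → ℕ) → sum (tabulate {n = n} (f ∘ toℕ)) ≡ ∑< n f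
    sum-tabulate zero f = refl
    sum-tabulate (suc n) f = cong (f 0 +_) (sum-tabulate n (f ∘ suc))

  ∑∈allFin-≟ : ∀ {n} (z : Fin n) → ∑[ c ∈ allFin n ] 𝟙 (c ≟ᶠ z) ≡ 1
  ∑∈allFin-≟ {n} z = begin
    ∑[ c ∈ allFin n ] 𝟙 (c ≟ᶠ z)
      ≡⟨ ∑∈-cong (allFin n) (λ c → 𝟙-cong (mk⇔ (cong toℕ) toℕ-injective) (c ≟ᶠ z) (toℕ c ≟ toℕ z)) ⟩
    ∑[ c ∈ allFin n ] 𝟙 (toℕ c ≟ toℕ z)
      ≡⟨ ∑∈allFin n (λ i → 𝟙 (i ≟ toℕ z)) ⟩
    ∑[ i < n ] 𝟙 (i ≟ toℕ z)
      ≡⟨ ∑-delta n (toℕ<n z) ⟩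
    1 ∎

  ∑∈allFin-sift : ∀ {n} (z : Fin n) (f : Fin n → ℕ) → ∑[ c ∈ allFin n ] (𝟙 (c ≟ᶠ z) * f c) ≡ f z
  ∑∈allFin-sift {n} z f = begin
    ∑[ c ∈ allFin n ] (𝟙 (c ≟ᶠ z) * f c)  ≡⟨ ∑∈-cong (allFin n) sift ⟩
    ∑[ c ∈ allFin n ] (f z * 𝟙 (c ≟ᶠ z))  ≡⟨ ∑∈-*ˡ (f z) _ (allFin n) ⟩
    f z * ∑[ c ∈ allFin n ] 𝟙 (c ≟ᶠ z)    ≡⟨ cong (f z *_) (∑∈allFin-≟ z) ⟩
    f z * 1                                ≡⟨ *-identityʳ (f z) ⟩
    f z                                    ∎
    where
    sift : ∀ c → 𝟙 (c ≟ᶠ z) * f c ≡ f z * 𝟙 (c ≟ᶠ z)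
    sift c with c ≟ᶠ z
    ... | yes refl = *-comm 1 (f c)
    ... | no _ = sym (*-zeroʳ (f z))

  ∑∑∈allFin-sift : ∀ {n q p} {Q : Fin n → Fin n → Set q} {P : Set p}
                   (Q? : ∀ c d → Dec (Q c d)) (P? : Dec P) (c₀ d₀ : Fin n) →
                   (∀ c d → Q c d ⇔ (c ≡ c₀ × d ≡ d₀ × P)) →
                   ∑[ c ∈ allFin n ] ∑[ d ∈ allFin n ] 𝟙 (Q? c d) ≡ 𝟙 P?
  ∑∑∈allFin-sift {n} Q? P? c₀ d₀ Q⇔ = begin
    ∑[ c ∈ allFin n ] ∑[ d ∈ allFin n ] 𝟙 (Q? c d)
      ≡⟨ ∑∈-cong (allFin n) (λ c → ∑∈-cong (allFin n) (factor c)) ⟩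
    ∑[ c ∈ allFin n ] ∑[ d ∈ allFin n ] (𝟙 (c ≟ᶠ c₀) * (𝟙 (d ≟ᶠ d₀) * 𝟙 P?))
      ≡⟨ ∑∈-cong (allFin n) (λ c → ∑∈-*ˡ (𝟙 (c ≟ᶠ c₀)) (λ d → 𝟙 (d ≟ᶠ d₀) * 𝟙 P?) (allFin n)) ⟩
    ∑[ c ∈ allFin n ] (𝟙 (c ≟ᶠ c₀) * ∑[ d ∈ allFin n ] (𝟙 (d ≟ᶠ d₀) * 𝟙 P?))
      ≡⟨ ∑∈allFin-sift c₀ _ ⟩
    ∑[ d ∈ allFin n ] (𝟙 (d ≟ᶠ d₀) * 𝟙 P?)
      ≡⟨ ∑∈allFin-sift d₀ _ ⟩
    𝟙 P?
      ∎
    where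
    factor : ∀ c d → 𝟙 (Q? c d) ≡ 𝟙 (c ≟ᶠ c₀) * (𝟙 (d ≟ᶠ d₀) * 𝟙 P?)
    factor c d = begin
      𝟙 (Q? c d)                                ≡⟨ 𝟙-cong (Q⇔ c d) (Q? c d) (c ≟ᶠ c₀ ×-dec (d ≟ᶠ d₀ ×-dec P?)) ⟩
      𝟙 (c ≟ᶠ c₀ ×-dec (d ≟ᶠ d₀ ×-dec P?))      ≡⟨ 𝟙-× (c ≟ᶠ c₀) (d ≟ᶠ d₀ ×-dec P?) ⟩
      𝟙 (c ≟ᶠ c₀) * 𝟙 (d ≟ᶠ d₀ ×-dec P?)        ≡⟨ cong (𝟙 (c ≟ᶠ c₀) *_) (𝟙-× (d ≟ᶠ d₀) P?) ⟩
      𝟙 (c ≟ᶠ c₀) * (𝟙 (d ≟ᶠ d₀) * 𝟙 P?)        ∎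

  solutionCount : (n : ℕ) .{{_ : NonZero n}} → ℕ → ℕ → ℕ
  solutionCount n x r = ∑[ y < n ] 𝟙 ((x * y) % n ≟ r % n)

  productCount : (n : ℕ) .{{_ : NonZero n}} → ℕ → ℕ
  productCount n r = ∑[ x < n ] solutionCount n x r

module Congruence (n : ℤ) where
  open import Data.Integer.Base using (0ℤ; 1ℤ; _+_; _*_; -_; _-_)
  open import Data.Integer.Properties using (+-inverseʳ; *-zeroˡ)
  open import Data.Integer.Tactic.RingSolver using (solve)

  -- A record rather than n ∣ x - y itself, so that x and y are inferable from x ≈ y.
  infix 4 _≈_
  record _≈_ (x y : ℤ) : Set where
    constructor mod
    field ∣x-y : n ∣ x - y

  ≡⇒≈ : ∀ {x y} → x ≡ y → x ≈ y
  ≡⇒≈ {x} refl = mod (divides 0ℤ (trans (+-inverseʳ x) (sym (*-zeroˡ n))))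

  ≈-refl : ∀ {x} → x ≈ x
  ≈-refl = ≡⇒≈ refl

  ≈-sym : ∀ {x y} → x ≈ y → y ≈ x
  ≈-sym {x} {y} (mod x≈y) = mod $ begin
    n          ∣⟨ ∣m⇒∣-m x≈y ⟩
    - (x - y)  ≡⟨ solve (x ∷ y ∷ []) ⟩
    y - x      ∎
    where open ∣-Reasoning

  ≈-trans : ∀ {x y z} → x ≈ y → y ≈ z → x ≈ z
  ≈-trans {x} {y} {z} (mod x≈y) (mod y≈z) = mod $ begin
    n                  ∣⟨ ∣m∣n⇒∣m+n x≈y y≈z ⟩
    (x - y) + (y - z)  ≡⟨ solve (x ∷ y ∷ z ∷ []) ⟩
    x - z              ∎
    where open ∣-Reasoning

  +-cong : ∀ {x x′ y y′} → x ≈ x′ → y ≈ y′ → x + y ≈ x′ + y′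
  +-cong {x} {x′} {y} {y′} (mod x≈x′) (mod y≈y′) = mod $ begin
    n                     ∣⟨ ∣m∣n⇒∣m+n x≈x′ y≈y′ ⟩
    (x - x′) + (y - y′)   ≡⟨ solve (x ∷ x′ ∷ y ∷ y′ ∷ []) ⟩
    (x + y) - (x′ + y′)   ∎
    where open ∣-Reasoning

  *-cong : ∀ {x x′ y y′} → x ≈ x′ → y ≈ y′ → x * y ≈ x′ * y′
  *-cong {x} {x′} {y} {y′} (mod x≈x′) (mod y≈y′) = mod $ begin
    n                           ∣⟨ ∣m∣n⇒∣m+n (∣m⇒∣m*n y x≈x′) (∣n⇒∣m*n x′ y≈y′) ⟩
    (x - x′) * y + x′ * (y - y′) ≡⟨ solve (x ∷ x′ ∷ y ∷ y′ ∷ []) ⟩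
    x * y - x′ * y′             ∎
    where open ∣-Reasoning

  -‿cong : ∀ {x x′} → x ≈ x′ → - x ≈ - x′
  -‿cong {x} {x′} (mod x≈x′) = mod $ begin
    n           ∣⟨ ∣m⇒∣-m x≈x′ ⟩
    - (x - x′)  ≡⟨ solve (x ∷ x′ ∷ []) ⟩
    - x - - x′  ∎
    where open ∣-Reasoning

  +-congˡ : ∀ x {y y′} → y ≈ y′ → x + y ≈ x + y′
  +-congˡ x = +-cong (≈-refl {x})

  +-congʳ : ∀ y {x x′} → x ≈ x′ → x + y ≈ x′ + y
  +-congʳ y x≈x′ = +-cong x≈x′ (≈-refl {y})

  *-congˡ : ∀ x {y y′} → y ≈ y′ → x * y ≈ x * y′
  *-congˡ x = *-cong (≈-refl {x})

  *-congʳ : ∀ y {x x′} → x ≈ x′ → x * y ≈ x′ * y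
  *-congʳ y x≈x′ = *-cong x≈x′ (≈-refl {y})

  isEquivalence : IsEquivalence _≈_
  isEquivalence = record { refl = ≈-refl ; sym = ≈-sym ; trans = ≈-trans }

  setoid : Setoid 0ℓ 0ℓ
  setoid = record { isEquivalence = isEquivalence }

  module ≈-Reasoning = Relation.Binary.Reasoning.Setoid setoid

  ≈-respʳ-⇔ : ∀ {x y z} → y ≈ z → (x ≈ y ⇔ x ≈ z)
  ≈-respʳ-⇔ y≈z = mk⇔ (λ x≈y → ≈-trans x≈y y≈z) (λ x≈z → ≈-trans x≈z (≈-sym y≈z))

  x*u≈1⇒[x*y≈r⇔y≈u*r] : ∀ {x u y r} → x * u ≈ 1ℤ → (x * y ≈ r ⇔ y ≈ u * r)
  x*u≈1⇒[x*y≈r⇔y≈u*r] {x} {u} {y} {r} xu≈1 = mk⇔ to from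
    where
    open ≈-Reasoning
    to : x * y ≈ r → y ≈ u * r
    to xy≈r = begin
      y                ≡⟨ solve (y ∷ []) ⟩
      1ℤ * y           ≈⟨ *-congʳ y (≈-sym xu≈1) ⟩
      (x * u) * y      ≡⟨ solve (x ∷ u ∷ y ∷ []) ⟩
      u * (x * y)      ≈⟨ *-congˡ u xy≈r ⟩
      u * r            ∎
    from : y ≈ u * r → x * y ≈ r
    from y≈ur = begin
      x * y            ≈⟨ *-congˡ x y≈ur ⟩
      x * (u * r)      ≡⟨ solve (x ∷ u ∷ r ∷ []) ⟩
      (x * u) * r      ≈⟨ *-congʳ r xu≈1 ⟩
      1ℤ * r           ≡⟨ solve (r ∷ []) ⟩
      r                ∎

module _ where
  open import Data.Integer.Base using (+_; 0ℤ; 1ℤ; _+_; _*_; -_; _-_)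
  open import Data.Integer.Properties using (pos-*; *-identityʳ)
  open import Data.Integer.Tactic.RingSolver using (solve)
  open Congruence using (mod)

  -- Replacing u by 1 − 2tu multiplies the defect (1 + 2t)u − 1 by −2t.
  odd-inverse-lift : ∀ {n} t u → Congruence._≈_ n ((1ℤ + + 2 * t) * u) 1ℤ →
                     Congruence._≈_ (+ 2 * n) ((1ℤ + + 2 * t) * (1ℤ - + 2 * t * u)) 1ℤ
  odd-inverse-lift {n} t u (mod n∣defect) = mod $ begin
    + 2 * n                                   ∣⟨ ∣n⇒∣m*n (- t) (*-monoʳ-∣ (+ 2) n∣defect) ⟩
    - t * (+ 2 * ((1ℤ + + 2 * t) * u - 1ℤ))   ≡⟨ solve (t ∷ u ∷ []) ⟩
    (1ℤ + + 2 * t) * (1ℤ - + 2 * t * u) - 1ℤ  ∎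
    where open ∣-Reasoning

  odd-invertible : ∀ k t → ∃[ u ] Congruence._≈_ (+ (2 ℕ.^ k)) ((1ℤ + + 2 * t) * u) 1ℤ
  odd-invertible zero t = 0ℤ , mod (divides ((1ℤ + + 2 * t) * 0ℤ - 1ℤ) (sym (*-identityʳ _)))
  odd-invertible (suc k) t with odd-invertible k t
  ... | u , inverse = 1ℤ - + 2 * t * u ,
    subst (λ n → Congruence._≈_ n _ 1ℤ) (sym (pos-* 2 (2 ℕ.^ k))) (odd-inverse-lift t u inverse)

module _ (N : ℕ) .{{_ : NonZero N}} where
  open import Data.Integer.Base using (+_; -[1+_]; 1ℤ; _+_; _*_; -_; _-_)
  open import Data.Integer.Properties using (pos-+; pos-*; +-injective; neg-distribˡ-*)
  open import Data.Integer.DivMod using (_%ℕ_; _/ℕ_; n%ℕd<d; a≡a%ℕn+[a/ℕn]*n)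
  open import Data.Integer.Tactic.RingSolver using (solve-∀)
  open import Data.Nat.DivMod using (_%_; _/_; m≡m%n+[m/n]*n; [m+kn]%n≡m%n; m<n⇒m%n≡m)
  open import Data.Nat.Properties using (_≟_)
  open Congruence (+ N)

  private
    a≡b+[a-b] : ∀ a b → a ≡ b + (a - b)
    a≡b+[a-b] = solve-∀

    b≡a-[a-b] : ∀ a b → b ≡ a - (a - b)
    b≡a-[a-b] = solve-∀

    [b+c]-b≡c : ∀ b c → (b + c) - b ≡ c
    [b+c]-b≡c = solve-∀

    [r+a*n]-[r+b*n]≡[a-b]*n : ∀ r a b n → (r + a * n) - (r + b * n) ≡ (a - b) * n
    [r+a*n]-[r+b*n]≡[a-b]*n = solve-∀

    +-divMod : ∀ x → + x ≡ + (x % N) + + (x / N) * + N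
    +-divMod x = trans (cong +_ (m≡m%n+[m/n]*n x N)) (trans (pos-+ (x % N) _) (cong (λ z → + (x % N) + z) (pos-* (x / N) N)))

    %≡%-shift : ∀ {x y} k → + x ≡ + y + + k * + N → x % N ≡ y % N
    %≡%-shift {x} {y} k x≡y+kN = begin
      x % N                ≡⟨ cong (_% N) (+-injective (trans x≡y+kN (sym y+kN))) ⟩
      (y ℕ.+ k ℕ.* N) % N  ≡⟨ [m+kn]%n≡m%n y k N ⟩
      y % N                ∎
      where
      open ≡-Reasoning
      y+kN : + (y ℕ.+ k ℕ.* N) ≡ + y + + k * + N
      y+kN = trans (pos-+ y _) (cong (λ z → + y + z) (pos-* k N))

  %≡%⇔≈ : ∀ {x y} → x % N ≡ y % N ⇔ + x ≈ + y
  %≡%⇔≈ {x} {y} = mk⇔ to from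
    where
    open ≡-Reasoning
    to : x % N ≡ y % N → + x ≈ + y
    to x%≡y% = mod (divides (+ (x / N) - + (y / N)) (begin
      + x - + y
        ≡⟨ cong₂ _-_ (+-divMod x) (+-divMod y) ⟩
      (+ (x % N) + + (x / N) * + N) - (+ (y % N) + + (y / N) * + N)
        ≡⟨ cong (λ r → (+ (x % N) + + (x / N) * + N) - (+ r + + (y / N) * + N)) (sym x%≡y%) ⟩
      (+ (x % N) + + (x / N) * + N) - (+ (x % N) + + (y / N) * + N)
        ≡⟨ [r+a*n]-[r+b*n]≡[a-b]*n (+ (x % N)) (+ (x / N)) (+ (y / N)) (+ N) ⟩
      (+ (x / N) - + (y / N)) * + N
        ∎))
    from : + x ≈ + y → x % N ≡ y % N
    from (mod (divides (+ k) x-y≡kN)) =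
      %≡%-shift k (trans (a≡b+[a-b] (+ x) (+ y)) (cong (λ z → + y + z) x-y≡kN))
    from (mod (divides -[1+ k ] x-y≡-[1+k]N)) =
      sym (%≡%-shift (suc k) (begin
        + y                   ≡⟨ b≡a-[a-b] (+ x) (+ y) ⟩
        + x - (+ x - + y)     ≡⟨ cong (λ d → + x - d) x-y≡-[1+k]N ⟩
        + x - -[1+ k ] * + N  ≡⟨ cong (λ z → + x + z) (neg-distribˡ-* -[1+ k ] (+ N)) ⟩
        + x + + suc k * + N   ∎))

  <⇒%≡%⇔≡ : ∀ {x y} → x ℕ.< N → y ℕ.< N → x % N ≡ y % N ⇔ x ≡ y
  <⇒%≡%⇔≡ x<N y<N = mk⇔ (λ x%≡y% → trans (sym (m<n⇒m%n≡m x<N)) (trans x%≡y% (m<n⇒m%n≡m y<N))) (cong (_% N))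

  solutionCount-unit : ∀ {x} u → + x * u ≈ 1ℤ → ∀ r → solutionCount N x r ≡ 1
  solutionCount-unit {x} u xu≈1 r =
    trans (∑-cong N (λ {y} y<N → 𝟙-cong (solution⇔ y<N) ((x ℕ.* y) % N ≟ r % N) (y ≟ y₀))) (∑-delta N y₀<N)
    where
    y₀ : ℕ
    y₀ = (u * + r) %ℕ N
    y₀<N : y₀ ℕ.< N
    y₀<N = n%ℕd<d (u * + r) N
    ur≈y₀ : u * + r ≈ + y₀
    ur≈y₀ = mod (divides ((u * + r) /ℕ N)
      (trans (cong (_- + y₀) (a≡a%ℕn+[a/ℕn]*n (u * + r) N)) ([b+c]-b≡c (+ y₀) _)))
    solution⇔ : ∀ {y} → y ℕ.< N → (x ℕ.* y) % N ≡ r % N ⇔ y ≡ y₀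
    solution⇔ {y} y<N = begin
      (x ℕ.* y) % N ≡ r % N  ≈⟨ %≡%⇔≈ ⟩
      + (x ℕ.* y) ≈ + r      ≡⟨ cong (_≈ + r) (pos-* x y) ⟩
      + x * + y ≈ + r        ≈⟨ x*u≈1⇒[x*y≈r⇔y≈u*r] {+ x} {u} xu≈1 ⟩
      + y ≈ u * + r          ≈⟨ ≈-respʳ-⇔ ur≈y₀ ⟩
      + y ≈ + y₀             ≈⟨ ⇔-sym %≡%⇔≈ ⟩
      y % N ≡ y₀ % N         ≈⟨ <⇒%≡%⇔≡ y<N y₀<N ⟩
      y ≡ y₀                 ∎
      where open ⇔-Reasoning

module _ (n : ℕ) .{{_ : NonZero n}} where
  open import Data.Nat
  open import Data.Nat.Properties
  open import Data.Nat.DivMod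
  open ≡-Reasoning

  private instance
    2n≢0 : NonZero (2 * n)
    2n≢0 = m*n≢0 2 n
    n2≢0 : NonZero (n * 2)
    n2≢0 = m*n≢0 n 2

  [2a]%[2n]≡2[a%n] : ∀ a → (2 * a) % (2 * n) ≡ 2 * (a % n)
  [2a]%[2n]≡2[a%n] a = begin
    (2 * a) % (2 * n)  ≡⟨ cong (_% (2 * n)) (*-comm 2 a) ⟩
    (a * 2) % (2 * n)  ≡⟨ %-congʳ (*-comm 2 n) ⟩
    (a * 2) % (n * 2)  ≡⟨ m%n*o≡m*o%[n*o] a n 2 ⟨
    a % n * 2          ≡⟨ *-comm (a % n) 2 ⟩
    2 * (a % n)        ∎

  [2a]%[2n]≡[2b]%[2n]⇔a%n≡b%n : ∀ a b → (2 * a) % (2 * n) ≡ (2 * b) % (2 * n) ⇔ a % n ≡ b % n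
  [2a]%[2n]≡[2b]%[2n]⇔a%n≡b%n a b = mk⇔
    (λ eq → *-cancelˡ-≡ (a % n) (b % n) 2 (trans (sym ([2a]%[2n]≡2[a%n] a)) (trans eq ([2a]%[2n]≡2[a%n] b))))
    (λ eq → trans ([2a]%[2n]≡2[a%n] a) (trans (cong (2 *_) eq) (sym ([2a]%[2n]≡2[a%n] b))))

  solutionCount-double : ∀ i c → solutionCount (2 * n) (2 * i) (2 * c) ≡ 2 * solutionCount n i c
  solutionCount-double i c = begin
    ∑[ y < 2 * n ] 𝟙 ((2 * i * y) % (2 * n) ≟ (2 * c) % (2 * n))
      ≡⟨ ∑-cong (2 * n) (λ {y} _ → 𝟙-cong (halve y) ((2 * i * y) % (2 * n) ≟ (2 * c) % (2 * n)) ((i * y) % n ≟ c % n)) ⟩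
    ∑[ y < 2 * n ] 𝟙 ((i * y) % n ≟ c % n)
      ≡⟨ ∑-periodic n _ (λ y → cong (λ z → 𝟙 (z ≟ c % n)) (periodic y)) ⟩
    2 * solutionCount n i c
      ∎
    where
    halve : ∀ y → (2 * i * y) % (2 * n) ≡ (2 * c) % (2 * n) ⇔ (i * y) % n ≡ c % n
    halve y = subst (λ z → z % (2 * n) ≡ (2 * c) % (2 * n) ⇔ (i * y) % n ≡ c % n) (sym (*-assoc 2 i y)) ([2a]%[2n]≡[2b]%[2n]⇔a%n≡b%n (i * y) c)
    periodic : ∀ y → (i * (n + y)) % n ≡ (i * y) % n
    periodic y = trans (%-congˡ (trans (*-distribˡ-+ i n y) (+-comm (i * n) (i * y)))) ([m+kn]%n≡m%n (i * y) i n)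

  solutionCount-even-one : ∀ i → solutionCount (2 * n) (2 * i) 1 ≡ 0
  solutionCount-even-one i =
    trans (∑-cong (2 * n) (λ {y} _ → 𝟙-no (2iy≢1 y) ((2 * i * y) % (2 * n) ≟ 1 % (2 * n)))) (∑-zero (2 * n))
    where
    2iy≢1 : ∀ y → (2 * i * y) % (2 * n) ≢ 1 % (2 * n)
    2iy≢1 y eq = even≢odd ((i * y) % n) 0 (begin
      2 * ((i * y) % n)      ≡⟨ [2a]%[2n]≡2[a%n] (i * y) ⟨
      (2 * (i * y)) % (2 * n) ≡⟨ cong (_% (2 * n)) (*-assoc 2 i y) ⟨
      (2 * i * y) % (2 * n)   ≡⟨ eq ⟩
      1 % (2 * n)             ≡⟨ m<n⇒m%n≡m (*-monoʳ-≤ 2 (>-nonZero⁻¹ n)) ⟩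
      1                       ∎)

module _ (k : ℕ) where
  open import Data.Integer.Base using (+_; 1ℤ; _+_; _*_)
  open import Data.Integer.Properties using (pos-+; pos-*)
  open import Data.Nat.Properties using (m^n≢0)

  private instance
    2^k≢0 : NonZero (2 ℕ.^ k)
    2^k≢0 = m^n≢0 2 k

  solutionCount-odd : ∀ i r → solutionCount (2 ℕ.^ k) (1 ℕ.+ 2 ℕ.* i) r ≡ 1
  solutionCount-odd i r with odd-invertible k (+ i)
  ... | u , inverse = solutionCount-unit (2 ℕ.^ k) {1 ℕ.+ 2 ℕ.* i} u
    (subst (λ o → Congruence._≈_ (+ (2 ℕ.^ k)) (o * u) 1ℤ) (sym 1+2i) inverse) r
    where
    1+2i : + (1 ℕ.+ 2 ℕ.* i) ≡ 1ℤ + + 2 * + i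
    1+2i = trans (pos-+ 1 (2 ℕ.* i)) (cong (λ z → 1ℤ + z) (pos-* 2 i))

module _ (k : ℕ) where
  open import Data.Nat
  open import Data.Nat.Properties
  open ≡-Reasoning

  private instance
    2^k≢0 : NonZero (2 ^ k)
    2^k≢0 = m^n≢0 2 k
    2^1+k≢0 : NonZero (2 ^ suc k)
    2^1+k≢0 = m^n≢0 2 (suc k)

  productCount≡∑even+2^k : ∀ r → productCount (2 ^ suc k) r ≡
                           ∑[ i < 2 ^ k ] solutionCount (2 ^ suc k) (2 * i) r + 2 ^ k
  productCount≡∑even+2^k r = begin
    ∑[ x < 2 * 2 ^ k ] solutionCount (2 ^ suc k) x r
      ≡⟨ ∑-even-odd (2 ^ k) _ ⟩
    ∑[ i < 2 ^ k ] solutionCount (2 ^ suc k) (2 * i) r + ∑[ i < 2 ^ k ] solutionCount (2 ^ suc k) (1 + 2 * i) r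
      ≡⟨ cong₂ _+_ refl (∑-cong (2 ^ k) (λ {i} _ → solutionCount-odd (suc k) i r)) ⟩
    ∑[ i < 2 ^ k ] solutionCount (2 ^ suc k) (2 * i) r + ∑[ i < 2 ^ k ] 1
      ≡⟨ cong₂ _+_ refl (trans (∑-const (2 ^ k) 1) (*-identityʳ (2 ^ k))) ⟩
    ∑[ i < 2 ^ k ] solutionCount (2 ^ suc k) (2 * i) r + 2 ^ k
      ∎

  productCount-double : ∀ c → productCount (2 ^ suc k) (2 * c) ≡ 2 * productCount (2 ^ k) c + 2 ^ k
  productCount-double c = trans (productCount≡∑even+2^k (2 * c)) (cong (_+ 2 ^ k) (begin
    ∑[ i < 2 ^ k ] solutionCount (2 ^ suc k) (2 * i) (2 * c)  ≡⟨ ∑-cong (2 ^ k) (λ {i} _ → solutionCount-double (2 ^ k) i c) ⟩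
    ∑[ i < 2 ^ k ] (2 * solutionCount (2 ^ k) i c)            ≡⟨ ∑-*ˡ (2 ^ k) 2 _ ⟩
    2 * productCount (2 ^ k) c                                 ∎))

  productCount-one : productCount (2 ^ suc k) 1 ≡ 2 ^ k
  productCount-one = trans (productCount≡∑even+2^k 1) (cong (_+ 2 ^ k)
    (trans (∑-cong (2 ^ k) (λ {i} _ → solutionCount-even-one (2 ^ k) i)) (∑-zero (2 ^ k))))

module _ where
  open import Data.Nat
  open import Data.Nat.Properties
  open import Data.Nat.Tactic.RingSolver using (solve-∀)

  -- Instance search unfolds 2 ^ suc k and cannot solve NonZero (2 ^ suc k), hence the explicit instances.
  productCount-zero : ∀ k → productCount (2 ^ suc k) {{m^n≢0 2 (suc k)}} 0 ≡ (suc k + 2) * 2 ^ k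
  productCount-zero zero = refl
  productCount-zero (suc k) =
    trans (productCount-double (suc k) 0) $
    trans (cong (λ p → 2 * p + 2 ^ suc k) (productCount-zero k)) $
    arithmetic k (2 ^ k)
    where
    arithmetic : ∀ k p → 2 * ((suc k + 2) * p) + 2 * p ≡ (suc (suc k) + 2) * (2 * p)
    arithmetic = solve-∀

  productCount-two : ∀ k → productCount (2 ^ suc (suc k)) {{m^n≢0 2 (suc (suc k))}} 2 ≡ 2 ^ suc (suc k)
  productCount-two k =
    trans (productCount-double (suc k) 1) $
    trans (cong (λ p → 2 * p + 2 ^ suc k) (productCount-one k)) $
    cong (λ s → 2 * 2 ^ k + s) (sym (+-identityʳ (2 * 2 ^ k)))

record ℤMat : Set where
  constructor ℤmat
  field e₁₁ e₁₂ e₂₁ e₂₂ : ℤ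

module _ where
  open import Data.Integer.Base using (0ℤ; 1ℤ; _+_; _*_; -_; _-_)
  open import Data.Integer.Tactic.RingSolver using (solve)

  Iℤ -Iℤ : ℤMat
  Iℤ = ℤmat 1ℤ 0ℤ 0ℤ 1ℤ
  -Iℤ = ℤmat (- 1ℤ) 0ℤ 0ℤ (- 1ℤ)

  Sℤ : ℤ → ℤMat
  Sℤ a = ℤmat a (- 1ℤ) 1ℤ 0ℤ

  S·ℤ : ℤ → ℤMat → ℤMat
  S·ℤ x (ℤmat p q r s) = ℤmat (x * p - r) (x * q - s) p q

  M₄ℤ : ℤ → ℤ → ℤ → ℤ → ℤMat
  M₄ℤ A B C D = ℤmat (1ℤ - B * A - D * A - D * C + D * C * B * A) (B + D - D * C * B)
                     (C * B * A - C - A)                          (1ℤ - C * B)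

  S·S·S·S≡M₄ℤ : ∀ A B C D → S·ℤ D (S·ℤ C (S·ℤ B (Sℤ A))) ≡ M₄ℤ A B C D
  S·S·S·S≡M₄ℤ A B C D = ℤmat-≡ e₁₁ e₁₂ e₂₁ e₂₂
    where
    ℤmat-≡ : ∀ {a b c d a′ b′ c′ d′} → a ≡ a′ → b ≡ b′ → c ≡ c′ → d ≡ d′ → ℤmat a b c d ≡ ℤmat a′ b′ c′ d′
    ℤmat-≡ refl refl refl refl = refl
    e₁₁ : D * (C * (B * A - 1ℤ) - A) - (B * A - 1ℤ) ≡ 1ℤ - B * A - D * A - D * C + D * C * B * A
    e₁₁ = solve (A ∷ B ∷ C ∷ D ∷ [])
    e₁₂ : D * (C * (B * - 1ℤ - 0ℤ) - - 1ℤ) - (B * - 1ℤ - 0ℤ) ≡ B + D - D * C * B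
    e₁₂ = solve (B ∷ C ∷ D ∷ [])
    e₂₁ : C * (B * A - 1ℤ) - A ≡ C * B * A - C - A
    e₂₁ = solve (A ∷ B ∷ C ∷ [])
    e₂₂ : C * (B * - 1ℤ - 0ℤ) - - 1ℤ ≡ 1ℤ - C * B
    e₂₂ = solve (B ∷ C ∷ [])

module MatrixCongruence (n : ℤ) where
  open import Data.Integer.Base using (+_; 0ℤ; 1ℤ; _+_; _*_; -_; _-_)
  open import Data.Integer.Tactic.RingSolver using (solve)
  open Congruence n
  open ≈-Reasoning

  infix 4 _≋_
  record _≋_ (E F : ℤMat) : Set where
    constructor ⟨_,_,_,_⟩
    open ℤMat
    field
      e₁₁≈ : e₁₁ E ≈ e₁₁ F
      e₁₂≈ : e₁₂ E ≈ e₁₂ F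
      e₂₁≈ : e₂₁ E ≈ e₂₁ F
      e₂₂≈ : e₂₂ E ≈ e₂₂ F

  ≋-trans : ∀ {E F G} → E ≋ F → F ≋ G → E ≋ G
  ≋-trans ⟨ a , b , c , d ⟩ ⟨ a′ , b′ , c′ , d′ ⟩ = ⟨ ≈-trans a a′ , ≈-trans b b′ , ≈-trans c c′ , ≈-trans d d′ ⟩

  Sℤ-cong : ∀ {a a′} → a ≈ a′ → Sℤ a ≋ Sℤ a′
  Sℤ-cong a≈a′ = ⟨ a≈a′ , ≈-refl , ≈-refl , ≈-refl ⟩

  S·ℤ-cong : ∀ {x x′ E E′} → x ≈ x′ → E ≋ E′ → S·ℤ x E ≋ S·ℤ x′ E′
  S·ℤ-cong x≈x′ ⟨ p , q , r , s ⟩ = ⟨ +-cong (*-cong x≈x′ p) (-‿cong r) , +-cong (*-cong x≈x′ q) (-‿cong s) , p , q ⟩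

  M₄ℤ-cong : ∀ {A A′ B B′ C C′ D D′} → A ≈ A′ → B ≈ B′ → C ≈ C′ → D ≈ D′ → M₄ℤ A B C D ≋ M₄ℤ A′ B′ C′ D′
  M₄ℤ-cong {A} {A′} {B} {B′} {C} {C′} {D} {D′} a b c d =
    subst₂ _≋_ (S·S·S·S≡M₄ℤ A B C D) (S·S·S·S≡M₄ℤ A′ B′ C′ D′)
      (S·ℤ-cong d (S·ℤ-cong c (S·ℤ-cong b (Sℤ-cong a))))

  M₄ℤ≋Iℤ⇒ : ∀ A B C D → M₄ℤ A B C D ≋ Iℤ → C ≈ - A × D ≈ - B × A * B ≈ 0ℤ
  M₄ℤ≋Iℤ⇒ A B C D ⟨ _ , e₁₂≈0 , e₂₁≈0 , e₂₂≈1 ⟩ = C≈-A , D≈-B , AB≈0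
    where
    CB≈0 : C * B ≈ 0ℤ
    CB≈0 = begin
      C * B               ≡⟨ solve (B ∷ C ∷ []) ⟩
      1ℤ - (1ℤ - C * B)   ≈⟨ +-congˡ 1ℤ (-‿cong e₂₂≈1) ⟩
      1ℤ - 1ℤ             ≡⟨⟩
      0ℤ                  ∎
    C≈-A : C ≈ - A
    C≈-A = begin
      C                                     ≡⟨ solve (A ∷ B ∷ C ∷ []) ⟩
      C * B * A - (C * B * A - C - A) - A   ≈⟨ +-congʳ (- A) (+-cong (*-congʳ A CB≈0) (-‿cong e₂₁≈0)) ⟩
      0ℤ * A - 0ℤ - A                       ≡⟨ solve (A ∷ []) ⟩
      - A                                   ∎
    D≈-B : D ≈ - B
    D≈-B = begin
      D                                      ≡⟨ solve (B ∷ C ∷ D ∷ []) ⟩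
      (B + D - D * C * B) + D * (C * B) - B  ≈⟨ +-congʳ (- B) (+-cong e₁₂≈0 (*-congˡ D CB≈0)) ⟩
      0ℤ + D * 0ℤ - B                        ≡⟨ solve (B ∷ D ∷ []) ⟩
      - B                                    ∎
    AB≈0 : A * B ≈ 0ℤ
    AB≈0 = begin
      A * B        ≡⟨ solve (A ∷ B ∷ []) ⟩
      - (- A * B)  ≈⟨ -‿cong (*-congʳ B (≈-sym C≈-A)) ⟩
      - (C * B)    ≈⟨ -‿cong CB≈0 ⟩
      - 0ℤ         ≡⟨⟩
      0ℤ           ∎

  M₄ℤ≋Iℤ⇐ : ∀ A B C D → C ≈ - A × D ≈ - B × A * B ≈ 0ℤ → M₄ℤ A B C D ≋ Iℤ
  M₄ℤ≋Iℤ⇐ A B C D (C≈-A , D≈-B , AB≈0) = ≋-trans (M₄ℤ-cong ≈-refl ≈-refl C≈-A D≈-B) ⟨ e₁₁ , e₁₂ , e₂₁ , e₂₂ ⟩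
    where
    e₁₁ : 1ℤ - B * A - - B * A - - B * - A + - B * - A * B * A ≈ 1ℤ
    e₁₁ = begin
      1ℤ - B * A - - B * A - - B * - A + - B * - A * B * A  ≡⟨ solve (A ∷ B ∷ []) ⟩
      1ℤ - A * B + A * B * (A * B)                          ≈⟨ +-cong (+-congˡ 1ℤ (-‿cong AB≈0)) (*-cong AB≈0 AB≈0) ⟩
      1ℤ - 0ℤ + 0ℤ * 0ℤ                                     ≡⟨⟩
      1ℤ                                                    ∎
    e₁₂ : B + - B - - B * - A * B ≈ 0ℤ
    e₁₂ = begin
      B + - B - - B * - A * B  ≡⟨ solve (A ∷ B ∷ []) ⟩
      - (A * B * B)            ≈⟨ -‿cong (*-congʳ B AB≈0) ⟩
      - (0ℤ * B)               ≡⟨ solve (B ∷ []) ⟩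
      0ℤ                       ∎
    e₂₁ : - A * B * A - - A - A ≈ 0ℤ
    e₂₁ = begin
      - A * B * A - - A - A  ≡⟨ solve (A ∷ B ∷ []) ⟩
      - (A * B * A)          ≈⟨ -‿cong (*-congʳ A AB≈0) ⟩
      - (0ℤ * A)             ≡⟨ solve (A ∷ []) ⟩
      0ℤ                     ∎
    e₂₂ : 1ℤ - - A * B ≈ 1ℤ
    e₂₂ = begin
      1ℤ - - A * B  ≡⟨ solve (A ∷ B ∷ []) ⟩
      1ℤ + A * B    ≈⟨ +-congˡ 1ℤ AB≈0 ⟩
      1ℤ + 0ℤ       ≡⟨⟩
      1ℤ            ∎

  M₄ℤ≋Iℤ⇔ : ∀ A B C D → M₄ℤ A B C D ≋ Iℤ ⇔ (C ≈ - A × D ≈ - B × A * B ≈ 0ℤ)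
  M₄ℤ≋Iℤ⇔ A B C D = mk⇔ (M₄ℤ≋Iℤ⇒ A B C D) (M₄ℤ≋Iℤ⇐ A B C D)

  M₄ℤ≋-Iℤ⇒ : ∀ A B C D → M₄ℤ A B C D ≋ -Iℤ → C ≈ A × D ≈ B × A * B ≈ + 2
  M₄ℤ≋-Iℤ⇒ A B C D ⟨ _ , e₁₂≈0 , e₂₁≈0 , e₂₂≈-1 ⟩ = C≈A , D≈B , AB≈2
    where
    CB≈2 : C * B ≈ + 2
    CB≈2 = begin
      C * B               ≡⟨ solve (B ∷ C ∷ []) ⟩
      1ℤ - (1ℤ - C * B)   ≈⟨ +-congˡ 1ℤ (-‿cong e₂₂≈-1) ⟩
      1ℤ - - 1ℤ           ≡⟨⟩
      + 2                 ∎
    C≈A : C ≈ A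
    C≈A = begin
      C                                     ≡⟨ solve (A ∷ B ∷ C ∷ []) ⟩
      C * B * A - (C * B * A - C - A) - A   ≈⟨ +-congʳ (- A) (+-cong (*-congʳ A CB≈2) (-‿cong e₂₁≈0)) ⟩
      + 2 * A - 0ℤ - A                      ≡⟨ solve (A ∷ []) ⟩
      A                                     ∎
    D≈B : D ≈ B
    D≈B = begin
      D                                                  ≡⟨ solve (B ∷ C ∷ D ∷ []) ⟩
      B - (B + D - D * C * B) + (D * + 2 - D * (C * B))  ≈⟨ +-cong (+-congˡ B (-‿cong e₁₂≈0)) (+-congˡ (D * + 2) (-‿cong (*-congˡ D CB≈2))) ⟩
      B - 0ℤ + (D * + 2 - D * + 2)                       ≡⟨ solve (B ∷ D ∷ []) ⟩
      B                                                  ∎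
    AB≈2 : A * B ≈ + 2
    AB≈2 = begin
      A * B  ≈⟨ *-congʳ B (≈-sym C≈A) ⟩
      C * B  ≈⟨ CB≈2 ⟩
      + 2    ∎

  M₄ℤ≋-Iℤ⇐ : ∀ A B C D → C ≈ A × D ≈ B × A * B ≈ + 2 → M₄ℤ A B C D ≋ -Iℤ
  M₄ℤ≋-Iℤ⇐ A B C D (C≈A , D≈B , AB≈2) = ≋-trans (M₄ℤ-cong ≈-refl ≈-refl C≈A D≈B) ⟨ e₁₁ , e₁₂ , e₂₁ , e₂₂ ⟩
    where
    e₁₁ : 1ℤ - B * A - B * A - B * A + B * A * B * A ≈ - 1ℤ
    e₁₁ = begin
      1ℤ - B * A - B * A - B * A + B * A * B * A  ≡⟨ solve (A ∷ B ∷ []) ⟩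
      1ℤ - + 3 * (A * B) + A * B * (A * B)        ≈⟨ +-cong (+-congˡ 1ℤ (-‿cong (*-congˡ (+ 3) AB≈2))) (*-cong AB≈2 AB≈2) ⟩
      1ℤ - + 3 * + 2 + + 2 * + 2                  ≡⟨⟩
      - 1ℤ                                        ∎
    e₁₂ : B + B - B * A * B ≈ 0ℤ
    e₁₂ = begin
      B + B - B * A * B        ≡⟨ solve (A ∷ B ∷ []) ⟩
      B * + 2 - B * (A * B)    ≈⟨ +-congˡ (B * + 2) (-‿cong (*-congˡ B AB≈2)) ⟩
      B * + 2 - B * + 2        ≡⟨ solve (B ∷ []) ⟩
      0ℤ                       ∎
    e₂₁ : A * B * A - A - A ≈ 0ℤ
    e₂₁ = begin
      A * B * A - A - A        ≡⟨ solve (A ∷ B ∷ []) ⟩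
      A * (A * B) - A * + 2    ≈⟨ +-congʳ (- (A * + 2)) (*-congˡ A AB≈2) ⟩
      A * + 2 - A * + 2        ≡⟨ solve (A ∷ []) ⟩
      0ℤ                       ∎
    e₂₂ : 1ℤ - A * B ≈ - 1ℤ
    e₂₂ = begin
      1ℤ - A * B  ≈⟨ +-congˡ 1ℤ (-‿cong AB≈2) ⟩
      1ℤ - + 2    ≡⟨⟩
      - 1ℤ        ∎

  M₄ℤ≋-Iℤ⇔ : ∀ A B C D → M₄ℤ A B C D ≋ -Iℤ ⇔ (C ≈ A × D ≈ B × A * B ≈ + 2)
  M₄ℤ≋-Iℤ⇔ A B C D = mk⇔ (M₄ℤ≋-Iℤ⇒ A B C D) (M₄ℤ≋-Iℤ⇐ A B C D)

module _ (N : ℕ) .{{_ : NonZero N}} where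
  open import Data.Integer.Base using (+_; 0ℤ; 1ℤ; -1ℤ; _+_; _*_; -_; _-_)
  open import Data.Integer.Properties using (pos-+; pos-*; neg-involutive; *-identityˡ; -1*i≡-i)
  open import Data.Integer.Tactic.RingSolver using (solve-∀)
  open import Data.Nat.DivMod using (m%n<n; m%n%n≡m%n)
  open import Data.Nat.Properties using (m∸n+n≡m; <⇒≤)
  open ZMod N
  open Congruence (+ N)
  open MatrixCongruence (+ N)

  toℤ : Zn → ℤ
  toℤ a = + toℕ a

  toℤ-[] : ∀ k → toℤ [ k ] ≈ + k
  toℤ-[] k = ≈-trans (≡⇒≈ (cong +_ (toℕ-fromℕ< (m%n<n k N)))) (Equivalence.to (%≡%⇔≈ N) (m%n%n≡m%n k N))

  toℤ-injective : ∀ {a b} → toℤ a ≈ toℤ b → a ≡ b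
  toℤ-injective {a} {b} a≈b = toℕ-injective (Equivalence.to (<⇒%≡%⇔≡ N (toℕ<n a) (toℕ<n b)) (Equivalence.from (%≡%⇔≈ N) a≈b))

  toℤ-≡⇔≈ : ∀ {x y X Y} → toℤ x ≈ X → toℤ y ≈ Y → (x ≡ y ⇔ X ≈ Y)
  toℤ-≡⇔≈ x≈X y≈Y = mk⇔
    (λ { refl → ≈-trans (≈-sym x≈X) y≈Y })
    (λ X≈Y → toℤ-injective (≈-trans x≈X (≈-trans X≈Y (≈-sym y≈Y))))

  toℤ-+ₙ : ∀ a b → toℤ (a +ₙ b) ≈ toℤ a + toℤ b
  toℤ-+ₙ a b = ≈-trans (toℤ-[] _) (≡⇒≈ (pos-+ (toℕ a) (toℕ b)))

  toℤ-*ₙ : ∀ a b → toℤ (a *ₙ b) ≈ toℤ a * toℤ b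
  toℤ-*ₙ a b = ≈-trans (toℤ-[] _) (≡⇒≈ (pos-* (toℕ a) (toℕ b)))

  toℤ-negₙ : ∀ a → toℤ (-ₙ a) ≈ - toℤ a
  toℤ-negₙ a = ≈-trans (toℤ-[] (N ℕ.∸ toℕ a)) (mod (divides 1ℤ (begin
    + (N ℕ.∸ toℕ a) - - toℤ a    ≡⟨ cong (λ z → + (N ℕ.∸ toℕ a) + z) (neg-involutive (toℤ a)) ⟩
    + (N ℕ.∸ toℕ a) + toℤ a      ≡⟨ pos-+ (N ℕ.∸ toℕ a) (toℕ a) ⟨
    + (N ℕ.∸ toℕ a ℕ.+ toℕ a)    ≡⟨ cong +_ (m∸n+n≡m (<⇒≤ (toℕ<n a))) ⟩
    + N                          ≡⟨ *-identityˡ (+ N) ⟨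
    1ℤ * + N                     ∎)))
    where open ≡-Reasoning

  toℤ-0ₙ : toℤ 0ₙ ≈ 0ℤ
  toℤ-0ₙ = toℤ-[] 0

  toℤ-1ₙ : toℤ 1ₙ ≈ 1ℤ
  toℤ-1ₙ = toℤ-[] 1

  toℤ-neg1ₙ : toℤ (-ₙ 1ₙ) ≈ -1ℤ
  toℤ-neg1ₙ = ≈-trans (toℤ-negₙ 1ₙ) (-‿cong toℤ-1ₙ)

  lift : Mat → ℤMat
  lift (mat a b c d) = ℤmat (toℤ a) (toℤ b) (toℤ c) (toℤ d)

  lift-≡⇔≋ : ∀ {M T E F} → lift M ≋ E → lift T ≋ F → (M ≡ T ⇔ E ≋ F)
  lift-≡⇔≋ {M} {T} ⟨ a , b , c , d ⟩ ⟨ a′ , b′ , c′ , d′ ⟩ = mk⇔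
    (λ { refl → ⟨ ≈-trans (≈-sym a) a′ , ≈-trans (≈-sym b) b′ , ≈-trans (≈-sym c) c′ , ≈-trans (≈-sym d) d′ ⟩ })
    (λ { ⟨ a″ , b″ , c″ , d″ ⟩ → mat-≡ (entry a a″ a′) (entry b b″ b′) (entry c c″ c′) (entry d d″ d′) })
    where
    entry : ∀ {x y X Y} → toℤ x ≈ X → X ≈ Y → toℤ y ≈ Y → x ≡ y
    entry x≈X X≈Y y≈Y = Equivalence.from (toℤ-≡⇔≈ x≈X y≈Y) X≈Y
    mat-≡ : Mat.e₁₁ M ≡ Mat.e₁₁ T → Mat.e₁₂ M ≡ Mat.e₁₂ T → Mat.e₂₁ M ≡ Mat.e₂₁ T → Mat.e₂₂ M ≡ Mat.e₂₂ T → M ≡ T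
    mat-≡ refl refl refl refl = refl

  lift-S : ∀ a → lift (S a) ≋ Sℤ (toℤ a)
  lift-S a = ⟨ ≈-refl , toℤ-neg1ₙ , toℤ-1ₙ , toℤ-0ₙ ⟩

  lift-S· : ∀ x {M E} → lift M ≋ E → lift (S x · M) ≋ S·ℤ (toℤ x) E
  lift-S· x {mat p q r s} {ℤmat P Q R S′} ⟨ p≈P , q≈Q , r≈R , s≈S′ ⟩ =
    ⟨ ≈-trans (row-entry x p (-ₙ 1ₙ) r ≈-refl p≈P toℤ-neg1ₙ r≈R) (≡⇒≈ (cong (λ z → toℤ x * P + z) (-1*i≡-i R)))
    , ≈-trans (row-entry x q (-ₙ 1ₙ) s ≈-refl q≈Q toℤ-neg1ₙ s≈S′) (≡⇒≈ (cong (λ z → toℤ x * Q + z) (-1*i≡-i S′)))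
    , ≈-trans (row-entry 1ₙ p 0ₙ r toℤ-1ₙ p≈P toℤ-0ₙ r≈R) (≡⇒≈ (1*p+0*r≡p P R))
    , ≈-trans (row-entry 1ₙ q 0ₙ s toℤ-1ₙ q≈Q toℤ-0ₙ s≈S′) (≡⇒≈ (1*p+0*r≡p Q S′))
    ⟩
    where
    1*p+0*r≡p : ∀ p r → 1ℤ * p + 0ℤ * r ≡ p
    1*p+0*r≡p = solve-∀
    row-entry : ∀ u v w z {U V W Z} → toℤ u ≈ U → toℤ v ≈ V → toℤ w ≈ W → toℤ z ≈ Z →
                toℤ ((u *ₙ v) +ₙ (w *ₙ z)) ≈ U * V + W * Z
    row-entry u v w z u≈U v≈V w≈W z≈Z =
      ≈-trans (toℤ-+ₙ (u *ₙ v) (w *ₙ z))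
        (+-cong (≈-trans (toℤ-*ₙ u v) (*-cong u≈U v≈V)) (≈-trans (toℤ-*ₙ w z) (*-cong w≈W z≈Z)))

  lift-M₄ : ∀ a b c d → lift (M₄ a b c d) ≋ M₄ℤ (toℤ a) (toℤ b) (toℤ c) (toℤ d)
  lift-M₄ a b c d = subst (lift (M₄ a b c d) ≋_) (S·S·S·S≡M₄ℤ (toℤ a) (toℤ b) (toℤ c) (toℤ d))
    (lift-S· d (lift-S· c (lift-S· b (lift-S a))))

  M₄≡Id⇔ : ∀ a b c d → M₄ a b c d ≡ Id ⇔ (c ≡ -ₙ a × d ≡ -ₙ b × a *ₙ b ≡ 0ₙ)
  M₄≡Id⇔ a b c d = begin
    M₄ a b c d ≡ Id                                  ≈⟨ lift-≡⇔≋ (lift-M₄ a b c d) ⟨ toℤ-1ₙ , toℤ-0ₙ , toℤ-0ₙ , toℤ-1ₙ ⟩ ⟩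
    M₄ℤ A B C D ≋ Iℤ                   ≈⟨ M₄ℤ≋Iℤ⇔ A B C D ⟩
    (C ≈ - A × D ≈ - B × A * B ≈ 0ℤ)                 ≈⟨ ⇔-sym (toℤ-≡⇔≈ ≈-refl (toℤ-negₙ a) ×-⇔ toℤ-≡⇔≈ ≈-refl (toℤ-negₙ b) ×-⇔ toℤ-≡⇔≈ (toℤ-*ₙ a b) toℤ-0ₙ) ⟩
    (c ≡ -ₙ a × d ≡ -ₙ b × a *ₙ b ≡ 0ₙ)              ∎
    where
    open ⇔-Reasoning
    A B C D : ℤ
    A = toℤ a
    B = toℤ b
    C = toℤ c
    D = toℤ d

  M₄≡-Id⇔ : ∀ a b c d → M₄ a b c d ≡ -Id ⇔ (c ≡ a × d ≡ b × a *ₙ b ≡ [ 2 ])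
  M₄≡-Id⇔ a b c d = begin
    M₄ a b c d ≡ -Id                                 ≈⟨ lift-≡⇔≋ (lift-M₄ a b c d) ⟨ toℤ-neg1ₙ , toℤ-0ₙ , toℤ-0ₙ , toℤ-neg1ₙ ⟩ ⟩
    M₄ℤ A B C D ≋ -Iℤ           ≈⟨ M₄ℤ≋-Iℤ⇔ A B C D ⟩
    (C ≈ A × D ≈ B × A * B ≈ + 2)                    ≈⟨ ⇔-sym (toℤ-≡⇔≈ ≈-refl ≈-refl ×-⇔ toℤ-≡⇔≈ ≈-refl ≈-refl ×-⇔ toℤ-≡⇔≈ (toℤ-*ₙ a b) (toℤ-[] 2)) ⟩
    (c ≡ a × d ≡ b × a *ₙ b ≡ [ 2 ])                 ∎
    where
    open ⇔-Reasoning
    A B C D : ℤ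
    A = toℤ a
    B = toℤ b
    C = toℤ c
    D = toℤ d

module _ (N : ℕ) .{{_ : NonZero N}} where
  open import Data.Nat using (_*_)
  open import Data.Nat.DivMod using (_%_)
  open import Data.Nat.Properties using (_≟_)
  open ZMod N
  open ≡-Reasoning

  *ₙ≡[]⇔ : ∀ a b r → a *ₙ b ≡ [ r ] ⇔ (toℕ a * toℕ b) % N ≡ r % N
  *ₙ≡[]⇔ a b r = mk⇔
    (λ ab≡r → trans (sym (toℕ-fromℕ< _)) (trans (cong toℕ ab≡r) (toℕ-fromℕ< _)))
    (λ ab%≡r% → toℕ-injective (trans (toℕ-fromℕ< _) (trans ab%≡r% (sym (toℕ-fromℕ< _)))))

  count₄≡∑⁴ : ∀ T → count₄ T ≡
              ∑[ a ∈ allFin N ] ∑[ b ∈ allFin N ] ∑[ c ∈ allFin N ] ∑[ d ∈ allFin N ] 𝟙 (M₄ a b c d ≟ₘ T)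
  count₄≡∑⁴ T =
    trans (length-filter _ tuples₄) $ trans (∑∈-concatMap _ _ all) $ ∑∈-cong all λ a →
    trans (∑∈-concatMap _ _ all) $ ∑∈-cong all λ b →
    trans (∑∈-concatMap _ _ all) $ ∑∈-cong all λ c →
    ∑∈-map _ _ all
    where
    all : List Zn
    all = allFin N

  count₄≡productCount : ∀ {T} r {c₀ d₀ : Zn → Zn} →
                        (∀ a b c d → M₄ a b c d ≡ T ⇔ (c ≡ c₀ a × d ≡ d₀ b × a *ₙ b ≡ [ r ])) →
                        count₄ T ≡ productCount N r
  count₄≡productCount {T} r {c₀} {d₀} M₄≡T⇔ = begin
    count₄ T
      ≡⟨ count₄≡∑⁴ T ⟩
    ∑[ a ∈ all ] ∑[ b ∈ all ] ∑[ c ∈ all ] ∑[ d ∈ all ] 𝟙 (M₄ a b c d ≟ₘ T)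
      ≡⟨ ∑∈-cong all (λ a → ∑∈-cong all (λ b →
           ∑∑∈allFin-sift (λ c d → M₄ a b c d ≟ₘ T) (a *ₙ b ≟ᶠ [ r ]) (c₀ a) (d₀ b) (M₄≡T⇔ a b))) ⟩
    ∑[ a ∈ all ] ∑[ b ∈ all ] 𝟙 (a *ₙ b ≟ᶠ [ r ])
      ≡⟨ ∑∈-cong all (λ a → ∑∈-cong all (λ b →
           𝟙-cong (*ₙ≡[]⇔ a b r) (a *ₙ b ≟ᶠ [ r ]) ((toℕ a * toℕ b) % N ≟ r % N))) ⟩
    ∑[ a ∈ all ] ∑[ b ∈ all ] 𝟙 ((toℕ a * toℕ b) % N ≟ r % N)
      ≡⟨ ∑∈-cong all (λ a → ∑∈allFin N (λ y → 𝟙 ((toℕ a * y) % N ≟ r % N))) ⟩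
    ∑[ a ∈ all ] solutionCount N (toℕ a) r
      ≡⟨ ∑∈allFin N (λ x → solutionCount N x r) ⟩
    productCount N r
      ∎
    where
    all : List Zn
    all = allFin N

open import Data.Nat.Base using (_≤_; _+_; _*_; _∸_; _^_; s≤s)
open import Data.Nat.Properties using (m^n≢0)

proposition2p8 : (m : ℕ) → 2 ≤ m →
    (w⁺ m ≡ (m + 2) * 2 ^ (m ∸ 1)) × (w⁻ m ≡ 2 ^ m)
proposition2p8 zero ()
proposition2p8 (suc zero) (s≤s ())
proposition2p8 m@(suc (suc k)) _ =
    trans (count₄≡productCount (2 ^ m) {{2^m≢0}} 0 (M₄≡Id⇔ (2 ^ m) {{2^m≢0}})) (productCount-zero (suc k))
  , trans (count₄≡productCount (2 ^ m) {{2^m≢0}} 2 (M₄≡-Id⇔ (2 ^ m) {{2^m≢0}})) (productCount-two k)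
  where
  2^m≢0 : NonZero (2 ^ m)
  2^m≢0 = m^n≢0 2 m
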